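{- Let $T\subseteq X_0$ be a generalised nice set with $\langle P_{\{1,2,1\}}\rangle\subseteq T$. If $\{i,j\}\in\{\{2,5\},\{3,6\},\{4,7\}\}$ and $T\cap\{\{i,i\},\{j,j\},\{i,j\}\}\neq\emptyset$, then $\{\{i,i\},\{j,j\},\{i,j\}\}\subseteq T$.
   Context: Let $I=\{1,\dots,7\}$ and $I_0=I\cup\{0\}$. The Fano plane on $I$ has the seven lines $\{1,2,5\},\{5,6,7\},\{1,4,7\},\{1,3,6\},\{2,4,6\},\{2,3,7\},\{3,4,5\}$. For distinct $i,j\in I$, $i*j$ is the third point of the unique line containing $i$ and $j$. The operation is extended to $I_0$ by $0*i=i*0=i$ and $i*i=0$ for all $i\in I_0$. Let $X_0$ be the set of unordered pairs $\{i,j\}$ with $i,j\in I_0$, where $i=j$ is allowed. For $i,j,k\in I_0$ let $P_{\{i,j,k\}}=\{\{i,j\},\{j,k\},\{k,i\},\{i,j*k\},\{j,k*i\},\{k,i*j\}\}\subseteq X_0$. A subset $T\subseteq X_0$ is a generalised nice set if for all $i,j,k\in I_0$, $\{i,j\}\in T$ and $\{i*j,k\}\in T$ imply $P_{\{i,j,k\}}\subseteq T$. For $S\subseteq X_0$, $\langle S\rangle$ denotes the smallest generalised nice set containing $S$. -}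

module Defs where

open import Data.Nat using (ℕ; zero; suc; _≤ᵇ_)
open import Data.Fin using (Fin; toℕ)
open import Data.Product using (_×_; _,_)
open import Data.Bool using (if_then_else_)
open import Relation.Unary using (Pred; _⊆_; _∈_)
open import Level using (0ℓ)

I₀ : Set
I₀ = Fin 8

-- Fano product on 0..7 (lines 125,567,147,136,246,237,345),
-- extended by 0*i=i*0=i and i*i=0.
mulℕ : ℕ → ℕ → ℕ
mulℕ 0 0 = 0
mulℕ 0 1 = 1
mulℕ 0 2 = 2
mulℕ 0 3 = 3
mulℕ 0 4 = 4
mulℕ 0 5 = 5
mulℕ 0 6 = 6
mulℕ 0 7 = 7
mulℕ 1 0 = 1
mulℕ 1 1 = 0
mulℕ 1 2 = 5
mulℕ 1 3 = 6
mulℕ 1 4 = 7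
mulℕ 1 5 = 2
mulℕ 1 6 = 3
mulℕ 1 7 = 4
mulℕ 2 0 = 2
mulℕ 2 1 = 5
mulℕ 2 2 = 0
mulℕ 2 3 = 7
mulℕ 2 4 = 6
mulℕ 2 5 = 1
mulℕ 2 6 = 4
mulℕ 2 7 = 3
mulℕ 3 0 = 3
mulℕ 3 1 = 6
mulℕ 3 2 = 7
mulℕ 3 3 = 0
mulℕ 3 4 = 5
mulℕ 3 5 = 4
mulℕ 3 6 = 1
mulℕ 3 7 = 2
mulℕ 4 0 = 4
mulℕ 4 1 = 7
mulℕ 4 2 = 6
mulℕ 4 3 = 5
mulℕ 4 4 = 0
mulℕ 4 5 = 3
mulℕ 4 6 = 2
mulℕ 4 7 = 1
mulℕ 5 0 = 5
mulℕ 5 1 = 2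
mulℕ 5 2 = 1
mulℕ 5 3 = 4
mulℕ 5 4 = 3
mulℕ 5 5 = 0
mulℕ 5 6 = 7
mulℕ 5 7 = 6
mulℕ 6 0 = 6
mulℕ 6 1 = 3
mulℕ 6 2 = 4
mulℕ 6 3 = 1
mulℕ 6 4 = 2
mulℕ 6 5 = 7
mulℕ 6 6 = 0
mulℕ 6 7 = 5
mulℕ 7 0 = 7
mulℕ 7 1 = 4
mulℕ 7 2 = 3
mulℕ 7 3 = 2
mulℕ 7 4 = 1
mulℕ 7 5 = 6
mulℕ 7 6 = 5
mulℕ 7 7 = 0
mulℕ _ _ = 0

-- ℕ → I₀ (reduces mod nothing; only applied to values < 8)
toI : ℕ → I₀
toI 0 = Fin.zero
toI 1 = Fin.suc Fin.zero
toI 2 = Fin.suc (Fin.suc Fin.zero)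
toI 3 = Fin.suc (Fin.suc (Fin.suc Fin.zero))
toI 4 = Fin.suc (Fin.suc (Fin.suc (Fin.suc Fin.zero)))
toI 5 = Fin.suc (Fin.suc (Fin.suc (Fin.suc (Fin.suc Fin.zero))))
toI 6 = Fin.suc (Fin.suc (Fin.suc (Fin.suc (Fin.suc (Fin.suc Fin.zero)))))
toI _ = Fin.suc (Fin.suc (Fin.suc (Fin.suc (Fin.suc (Fin.suc (Fin.suc Fin.zero))))))

_*_ : I₀ → I₀ → I₀
i * j = toI (mulℕ (toℕ i) (toℕ j))

-- X₀: unordered pairs {i,j} (i = j allowed), represented canonically as
-- ordered pairs (a , b) with toℕ a ≤ toℕ b.
Pair : Set
Pair = I₀ × I₀

⦅_,_⦆ : I₀ → I₀ → Pair
⦅ i , j ⦆ = if toℕ i ≤ᵇ toℕ j then (i , j) else (j , i)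

SubX₀ : Set₁
SubX₀ = Pred Pair 0ℓ

_∈ₓ_ : Pair → SubX₀ → Set
p ∈ₓ T = T p

data P (i j k : I₀) : SubX₀ where
  p1 : ⦅ i , j ⦆ ∈ P i j k
  p2 : ⦅ j , k ⦆ ∈ P i j k
  p3 : ⦅ k , i ⦆ ∈ P i j k
  p4 : ⦅ i , j * k ⦆ ∈ P i j k
  p5 : ⦅ j , k * i ⦆ ∈ P i j k
  p6 : ⦅ k , i * j ⦆ ∈ P i j k

IsNice : SubX₀ → Set
IsNice T = ∀ i j k → ⦅ i , j ⦆ ∈ T → ⦅ i * j , k ⦆ ∈ T → P i j k ⊆ T

data ⟨_⟩ (S : SubX₀) : SubX₀ where
  base : ∀ {p} → p ∈ S → p ∈ ⟨ S ⟩
  close : ∀ i j k {p} → ⦅ i , j ⦆ ∈ ⟨ S ⟩ → ⦅ i * j , k ⦆ ∈ ⟨ S ⟩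
        → p ∈ P i j k → p ∈ ⟨ S ⟩

data Special : I₀ → I₀ → Set where
  s25 : Special (toI 2) (toI 5)
  s36 : Special (toI 3) (toI 6)
  s47 : Special (toI 4) (toI 7)

{-# OPTIONS --safe #-}
-- The extended Fano product makes I₀ an elementary abelian 2-group, and for
-- each pair {i, j} of the lemma, j = i * 1.  Once T contains {0,1} and {1,1}
-- (both forced by P_{1,2,1}), the nice-set axiom with k = 1 turns {i,i} or
-- {j,j} into {i,j}, and since i * j = 1 it turns {i,j} back into {i,i} and {j,j}.
module Submission where

open import Defs
open import Data.Fin using (zero; _≟_)
open import Data.Fin.Properties using (all?)
open import Data.Product using (_×_; _,_)
open import Data.Product.Properties using (≡-dec)
open import Data.Sum using (_⊎_; inj₁; inj₂)
open import Function using (_∘_)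
open import Relation.Binary.PropositionalEquality
  using (_≡_; sym; trans; cong; subst; module ≡-Reasoning)
open import Relation.Nullary.Decidable using (from-yes)
open import Relation.Unary using (_⊆_)

*-identityˡ : ∀ i → zero * i ≡ i
*-identityˡ = from-yes (all? λ i → zero * i ≟ i)

*-selfInverse : ∀ i → i * i ≡ zero
*-selfInverse = from-yes (all? λ i → i * i ≟ zero)

*-comm : ∀ i j → i * j ≡ j * i
*-comm = from-yes (all? λ i → all? λ j → i * j ≟ j * i)

*-assoc : ∀ i j k → (i * j) * k ≡ i * (j * k)
*-assoc = from-yes (all? λ i → all? λ j → all? λ k → (i * j) * k ≟ i * (j * k))

⦅⦆-comm : ∀ i j → ⦅ i , j ⦆ ≡ ⦅ j , i ⦆
⦅⦆-comm = from-yes (all? λ i → all? λ j → ≡-dec _≟_ _≟_ ⦅ i , j ⦆ ⦅ j , i ⦆)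

i*[i*j]≡j : ∀ i j → i * (i * j) ≡ j
i*[i*j]≡j i j = begin
  i * (i * j)  ≡⟨ sym (*-assoc i i j) ⟩
  (i * i) * j  ≡⟨ cong (_* j) (*-selfInverse i) ⟩
  zero * j     ≡⟨ *-identityˡ j ⟩
  j            ∎
  where open ≡-Reasoning

[i*j]*j≡i : ∀ i j → (i * j) * j ≡ i
[i*j]*j≡i i j = begin
  (i * j) * j  ≡⟨ *-comm (i * j) j ⟩
  j * (i * j)  ≡⟨ cong (j *_) (*-comm i j) ⟩
  j * (j * i)  ≡⟨ i*[i*j]≡j j i ⟩
  i            ∎
  where open ≡-Reasoning

module _ {T : SubX₀} (nice : IsNice T) where

  zero-pair-step : ∀ {j k} → ⦅ zero , j ⦆ ∈ₓ T → ⦅ j , k ⦆ ∈ₓ T → ⦅ zero , k ⦆ ∈ₓ T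
  zero-pair-step {j} {k} 0j∈T jk∈T = subst T (⦅⦆-comm k zero) k0∈T
    where
    k0∈T : ⦅ k , zero ⦆ ∈ₓ T
    k0∈T = nice zero j k 0j∈T (subst (λ x → ⦅ x , k ⦆ ∈ₓ T) (sym (*-identityˡ j)) jk∈T) p3

  diagonal⇒pair : ∀ {i k} → ⦅ zero , k ⦆ ∈ₓ T → ⦅ i , i ⦆ ∈ₓ T → ⦅ i , i * k ⦆ ∈ₓ T
  diagonal⇒pair {i} {k} 0k∈T ii∈T =
    nice i i k ii∈T (subst (λ x → ⦅ x , k ⦆ ∈ₓ T) (sym (*-selfInverse i)) 0k∈T) p4

  pair⇒diagonals : ∀ {i j} → ⦅ i , j ⦆ ∈ₓ T → ⦅ i * j , i * j ⦆ ∈ₓ T →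
                   ⦅ i , i ⦆ ∈ₓ T × ⦅ j , j ⦆ ∈ₓ T
  pair⇒diagonals {i} {j} ij∈T kk∈T =
      subst (λ x → ⦅ i , x ⦆ ∈ₓ T) j*[i*j]≡i (nice i j (i * j) ij∈T kk∈T p4)
    , subst (λ x → ⦅ j , x ⦆ ∈ₓ T) [i*j]*i≡j (nice i j (i * j) ij∈T kk∈T p5)
    where
    j*[i*j]≡i : j * (i * j) ≡ i
    j*[i*j]≡i = trans (cong (j *_) (*-comm i j)) (i*[i*j]≡j j i)
    [i*j]*i≡j : (i * j) * i ≡ j
    [i*j]*i≡j = trans (cong (_* i) (*-comm i j)) ([i*j]*j≡i j i)

  coset-allOrNothing : ∀ {c} → ⦅ zero , c ⦆ ∈ₓ T → ⦅ c , c ⦆ ∈ₓ T → ∀ i →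
    let j = i * c in
    (⦅ i , i ⦆ ∈ₓ T ⊎ ⦅ j , j ⦆ ∈ₓ T ⊎ ⦅ i , j ⦆ ∈ₓ T) →
    (⦅ i , i ⦆ ∈ₓ T × ⦅ j , j ⦆ ∈ₓ T × ⦅ i , j ⦆ ∈ₓ T)
  coset-allOrNothing {c} 0c∈T cc∈T i = all-from-pair ∘ pair-from-any
    where
    j = i * c
    all-from-pair : ⦅ i , j ⦆ ∈ₓ T → ⦅ i , i ⦆ ∈ₓ T × ⦅ j , j ⦆ ∈ₓ T × ⦅ i , j ⦆ ∈ₓ T
    all-from-pair ij∈T =
      let ii∈T , jj∈T = pair⇒diagonals ij∈T (subst (λ x → ⦅ x , x ⦆ ∈ₓ T) (sym (i*[i*j]≡j i c)) cc∈T)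
      in ii∈T , jj∈T , ij∈T
    pair-from-any : ⦅ i , i ⦆ ∈ₓ T ⊎ ⦅ j , j ⦆ ∈ₓ T ⊎ ⦅ i , j ⦆ ∈ₓ T → ⦅ i , j ⦆ ∈ₓ T
    pair-from-any (inj₁ ii∈T) = diagonal⇒pair 0c∈T ii∈T
    pair-from-any (inj₂ (inj₁ jj∈T)) =
      subst T (⦅⦆-comm j i) (subst (λ x → ⦅ j , x ⦆ ∈ₓ T) ([i*j]*j≡i i c) (diagonal⇒pair 0c∈T jj∈T))
    pair-from-any (inj₂ (inj₂ ij∈T)) = ij∈T

lemma5p1 : (T : SubX₀) → IsNice T → ⟨ P (toI 1) (toI 2) (toI 1) ⟩ ⊆ T →
    ∀ i j → Special i j →
    (⦅ i , i ⦆ ∈ₓ T ⊎ ⦅ j , j ⦆ ∈ₓ T ⊎ ⦅ i , j ⦆ ∈ₓ T) →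
    (⦅ i , i ⦆ ∈ₓ T × ⦅ j , j ⦆ ∈ₓ T × ⦅ i , j ⦆ ∈ₓ T)
lemma5p1 T nice P121⊆T _ _ = special
  where
  11∈T : ⦅ toI 1 , toI 1 ⦆ ∈ₓ T
  11∈T = P121⊆T (base p3)
  01∈T : ⦅ toI 0 , toI 1 ⦆ ∈ₓ T
  01∈T = zero-pair-step nice (P121⊆T (base p5)) (P121⊆T (base p1))
  special : ∀ {i j} → Special i j →
    (⦅ i , i ⦆ ∈ₓ T ⊎ ⦅ j , j ⦆ ∈ₓ T ⊎ ⦅ i , j ⦆ ∈ₓ T) →
    (⦅ i , i ⦆ ∈ₓ T × ⦅ j , j ⦆ ∈ₓ T × ⦅ i , j ⦆ ∈ₓ T)
  special s25 = coset-allOrNothing nice 01∈T 11∈T (toI 2)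
  special s36 = coset-allOrNothing nice 01∈T 11∈T (toI 3)
  special s47 = coset-allOrNothing nice 01∈T 11∈T (toI 4)
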